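{- Let $N$ be a positive integer and $p$ a prime such that the base-$p$ expansion of $N$ has digit-sum at least $3$. Then the $p$-threshold of $N$ with respect to $k=3$ equals $N - p^{e_1} - p^{e_2}$, where $p^{e_1}$ is the largest power of $p$ dividing $N$ and $p^{e_2}$ is the largest power of $p$ dividing $N - p^{e_1}$. More generally, for a positive integer $k$ such that the base-$p$ digit-sum of $N$ is at least $k$, the $p$-threshold of $N$ with respect to $k$ equals $N - p^{e_1} - \dots - p^{e_{k-1}}$, where for $t = 1,\dots,k-1$, $p^{e_t}$ is the largest power of $p$ dividing $N - p^{e_1} - \dots - p^{e_{t-1}}$.
   Context: For a prime $p$, a decomposition $N = c_1 + \dots + c_k$ of a positive integer $N$ as a sum of positive integers is called $p$-acceptable if the multinomial coefficient $N!/(c_1!\cdots c_k!)$ is not divisible by $p$; equivalently, for each $t\ge 0$, the coefficient of $p^t$ in the base-$p$ expansion of $N$ equals the sum of the coefficients of $p^t$ in the base-$p$ expansions of $c_1,\dots,c_k$ (no carrying in base $p$). If the base-$p$ digit-sum of $N$ is at least $k$, the $p$-threshold of $N$ with respect to $k$ is the greatest integer occurring as a summand in any $p$-acceptable expression of $N$ as a sum of $k$ positive integers. -}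

module Defs where

open import Data.Nat using (ℕ; zero; suc; _+_; _∸_; _^_; _≤_; NonZero)
open import Data.Nat.Properties using (m^n≢0)
open import Data.Nat.DivMod using (_/_; _%_)
open import Data.Nat.Divisibility using (_∣_)
open import Data.Nat.Primality using (Prime; prime⇒nonZero)
open import Data.List as List using (List; []; _∷_; upTo)
open import Data.Nat.ListAction using () renaming (sum to listSum)
open import Data.Vec as Vec using (Vec)
open import Data.Vec.Relation.Unary.All using (All)
open import Data.Vec.Membership.Propositional using (_∈_)
open import Data.Product using (_×_; Σ)
open import Data.Unit using (⊤)
open import Relation.Nullary using (¬_)
open import Relation.Binary.PropositionalEquality using (_≡_)

digit : {p : ℕ} → Prime p → (t n : ℕ) → ℕ
digit {p} pr t n =
  let instance nz = prime⇒nonZero pr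
      instance nz' = m^n≢0 p t
  in (n / p ^ t) % p

-- Base-p digit sum of n.  Since p ≥ 2 we have p^t > n for t ≥ n+1 (indeed t ≥ n),
-- so summing the digits of positions 0..n covers every nonzero digit.
digitSum : {p : ℕ} → Prime p → ℕ → ℕ
digitSum pr n = listSum (List.map (λ t → digit pr t n) (upTo (suc n)))

-- c₁ + ... + c_k = N is p-acceptable: positive summands, summing to N,
-- and no carrying in base p (digitwise additivity at every position t).
Acceptable : {p : ℕ} → Prime p → (N k : ℕ) → Vec ℕ k → Set
Acceptable pr N k c =
  All (λ cᵢ → 1 ≤ cᵢ) c
  × Vec.sum c ≡ N
  × (∀ (t : ℕ) → digit pr t N ≡ Vec.sum (Vec.map (digit pr t) c))

IsThreshold : {p : ℕ} → Prime p → (N k M : ℕ) → Set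
IsThreshold pr N k M =
  Σ (Vec ℕ k) (λ c → Acceptable pr N k c × M ∈ c)
  × (∀ (c : Vec ℕ k) → Acceptable pr N k c → ∀ x → x ∈ c → x ≤ M)

Greedy : (p : ℕ) → ℕ → List ℕ → Set
Greedy p m [] = ⊤
Greedy p m (e ∷ es) = (p ^ e ∣ m) × ¬ (p ^ suc e ∣ m) × Greedy p (m ∸ p ^ e) es

remainder : (p : ℕ) → ℕ → List ℕ → ℕ
remainder p m [] = m
remainder p m (e ∷ es) = remainder p (m ∸ p ^ e) es

{-# OPTIONS --safe #-}
-- Write every summand of an acceptable decomposition of N in base p: since nothing carries,
-- the decomposition just distributes the digit units p^t of N among k nonempty summands.
-- The greedy exponents e₁, e₂, … are the positions of the successive lowest nonzero digits,
-- so splitting off the k − 1 units p^{e₁}, …, p^{e_{k−1}} leaves N − Σ p^{e_i} as a summand.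
-- Conversely, the summands other than a given x add without carry to y = N − x, whose digits
-- are bounded by those of N and whose digit sum is at least k − 1. Exchanging the lowest unit
-- p^w of y for the lowest unit p^e of N (e ≤ w, since N has no digits below e) and inducting
-- gives y ≥ p^{e₁} + ⋯ + p^{e_{k−1}}.
module Submission where

open import Defs
open import Data.Nat.Base
open import Data.Nat.Properties
open import Data.Nat.DivMod
open import Data.Nat.Divisibility using (divides; _∣_; 1∣_; *-monoʳ-∣; *-cancelˡ-∣; m%n≡0⇒n∣m; n∣m⇒m%n≡0)
open import Data.Nat.Primality using (Prime; ¬prime[0]; ¬prime[1])
open import Data.Nat.Induction using (<-rec)
open import Data.List as List using (List; []; _∷_; upTo; applyUpTo; _∷ʳ_; length)
open import Data.List.Properties using (map-applyUpTo; applyUpTo-∷ʳ)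
open import Data.Nat.ListAction using () renaming (sum to listSum)
open import Data.Nat.ListAction.Properties using (sum-++)
open import Data.Vec as Vec using (Vec; []; _∷_)
open import Data.Vec.Properties using (map-id)
open import Data.Vec.Relation.Unary.All using (All; []; _∷_)
open import Data.Vec.Relation.Unary.Any using (here; there)
open import Data.Vec.Membership.Propositional using (_∈_)
open import Data.Product using (Σ; ∃; _×_; _,_; proj₁; proj₂)
open import Data.Unit using (tt; ⊤)
open import Data.Empty using (⊥-elim)
open import Data.Sum using (_⊎_; inj₁; inj₂)
open import Function using (_∘_; id)
open import Relation.Nullary using (¬_; Dec; yes; no)
open import Relation.Binary.PropositionalEquality
open import Algebra.Properties.CommutativeSemigroup +-commutativeSemigroup using (interchange; x∙yz≈y∙xz)

δ : ℕ → ℕ → ℕ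
δ zero    zero    = 1
δ zero    (suc _) = 0
δ (suc _) zero    = 0
δ (suc t) (suc e) = δ t e

δ-refl : ∀ t → δ t t ≡ 1
δ-refl zero    = refl
δ-refl (suc t) = δ-refl t

δ-≢ : ∀ {t e} → t ≢ e → δ t e ≡ 0
δ-≢ {zero}  {zero}  t≢e = ⊥-elim (t≢e refl)
δ-≢ {zero}  {suc e} _   = refl
δ-≢ {suc t} {zero}  _   = refl
δ-≢ {suc t} {suc e} t≢e = δ-≢ (t≢e ∘ cong suc)

n<m^n : ∀ {m} → 1 < m → ∀ n → n < m ^ n
n<m^n 1<m zero    = z<s
n<m^n {m} 1<m (suc n) = ≤-<-trans (n<m^n 1<m n) (^-monoʳ-< m 1<m (n<1+n n))

sum-upTo-suc : ∀ (f : ℕ → ℕ) F → listSum (List.map f (upTo (suc F))) ≡ listSum (List.map f (upTo F)) + f F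
sum-upTo-suc f F = begin
  listSum (List.map f (upTo (suc F)))       ≡⟨ cong listSum (map-applyUpTo id f (suc F)) ⟩
  listSum (applyUpTo f (suc F))             ≡⟨ cong listSum (applyUpTo-∷ʳ f F) ⟨
  listSum (applyUpTo f F ∷ʳ f F)            ≡⟨ sum-++ (applyUpTo f F) (f F ∷ []) ⟩
  listSum (applyUpTo f F) + (f F + 0)       ≡⟨ cong₂ _+_ (cong listSum (sym (map-applyUpTo id f F))) (+-identityʳ (f F)) ⟩
  listSum (List.map f (upTo F)) + f F       ∎
  where open ≡-Reasoning

sum-map-+ : ∀ {f g h : ℕ → ℕ} → (∀ t → h t ≡ f t + g t) → ∀ ts →
  listSum (List.map h ts) ≡ listSum (List.map f ts) + listSum (List.map g ts)
sum-map-+ h≡f+g []       = refl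
sum-map-+ {f} {g} {h} h≡f+g (t ∷ ts) = begin
  h t + listSum (List.map h ts)                                     ≡⟨ cong₂ _+_ (h≡f+g t) (sum-map-+ h≡f+g ts) ⟩
  (f t + g t) + (listSum (List.map f ts) + listSum (List.map g ts)) ≡⟨ interchange (f t) (g t) _ _ ⟩
  (f t + listSum (List.map f ts)) + (g t + listSum (List.map g ts)) ∎
  where open ≡-Reasoning

sum-δ-upTo-≤ : ∀ {F e} → F ≤ e → listSum (List.map (λ t → δ t e) (upTo F)) ≡ 0
sum-δ-upTo-≤ {zero}      _   = refl
sum-δ-upTo-≤ {suc F} {e} F<e = begin
  listSum (List.map (λ t → δ t e) (upTo (suc F)))   ≡⟨ sum-upTo-suc (λ t → δ t e) F ⟩
  listSum (List.map (λ t → δ t e) (upTo F)) + δ F e ≡⟨ cong₂ _+_ (sum-δ-upTo-≤ (<⇒≤ F<e)) (δ-≢ (<⇒≢ F<e)) ⟩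
  0                                                 ∎
  where open ≡-Reasoning

sum-δ-upTo : ∀ {F e} → e < F → listSum (List.map (λ t → δ t e) (upTo F)) ≡ 1
sum-δ-upTo {suc F} {e} (s≤s e≤F) = trans (sum-upTo-suc (λ t → δ t e) F) (last (m≤n⇒m<n∨m≡n e≤F))
  where
  last : e < F ⊎ e ≡ F → listSum (List.map (λ t → δ t e) (upTo F)) + δ F e ≡ 1
  last (inj₁ e<F)  = cong₂ _+_ (sum-δ-upTo e<F) (δ-≢ (>⇒≢ e<F))
  last (inj₂ refl) = cong₂ _+_ (sum-δ-upTo-≤ {F} ≤-refl) (δ-refl e)

split-∈ : ∀ {m} {x : ℕ} {c : Vec ℕ (suc m)} → x ∈ c →
  Σ (Vec ℕ m) λ c′ → (∀ f → Vec.sum (Vec.map f c) ≡ f x + Vec.sum (Vec.map f c′))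
                     × (∀ {P : ℕ → Set} → All P c → All P c′)
split-∈ {c = _ ∷ c} (here refl) = c , (λ f → refl) , λ { (_ ∷ pc) → pc }
split-∈ {suc m} {x} {a ∷ c} (there x∈c) with split-∈ x∈c
... | c′ , sum≡ , all′ = a ∷ c′ , (λ f → trans (cong (f a +_) (sum≡ f)) (x∙yz≈y∙xz (f a) (f x) _)) ,
                         λ { (pa ∷ pc) → pa ∷ all′ pc }

module Digits {p′ : ℕ} (pr : Prime (suc (suc p′))) where

  p : ℕ
  p = suc (suc p′)

  1<p : 1 < p
  1<p = s≤s (s≤s z≤n)

  digit-zero : ∀ n → digit pr 0 n ≡ n % p
  digit-zero n = cong (_% p) (n/1≡n n)

  digit-suc : ∀ t n → digit pr (suc t) n ≡ digit pr t (n / p)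
  digit-suc t n = cong (_% p) (sym (m/n/o≡m/[n*o] n p (p ^ t) {{_}} {{m^n≢0 p t}} {{m^n≢0 p (suc t)}}))

  digit<p : ∀ t n → digit pr t n < p
  digit<p t n = m%n<n ((n / p ^ t) {{m^n≢0 p t}}) p

  digit-of-0 : ∀ t → digit pr t 0 ≡ 0
  digit-of-0 t = cong (_% p) (0/n≡0 (p ^ t) {{m^n≢0 p t}})

  digit-zero-+* : ∀ {r} q → r < p → digit pr 0 (r + q * p) ≡ r
  digit-zero-+* {r} q r<p = trans (digit-zero (r + q * p)) (trans ([m+kn]%n≡m%n r q p) (m<n⇒m%n≡m r<p))

  digit-suc-+* : ∀ t {r} q → r < p → digit pr (suc t) (r + q * p) ≡ digit pr t q
  digit-suc-+* t {r} q r<p = trans (digit-suc t (r + q * p)) (cong (digit pr t) (begin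
    (r + q * p) / p   ≡⟨ +-distrib-/-∣ʳ r (divides q refl) ⟩
    r / p + q * p / p ≡⟨ cong₂ _+_ (m<n⇒m/n≡0 r<p) (m*n/n≡m q p) ⟩
    q                 ∎))
    where open ≡-Reasoning

  n≡p*[n/p] : ∀ n → n % p ≡ 0 → n ≡ p * (n / p)
  n≡p*[n/p] n n%p≡0 = trans (sym (m/n*n≡m (m%n≡0⇒n∣m n p n%p≡0))) (*-comm (n / p) p)

  digit-pow : ∀ t e → digit pr t (p ^ e) ≡ δ t e
  digit-pow zero    zero    = digit-zero-+* {1} 0 1<p
  digit-pow (suc t) zero    = trans (digit-suc-+* t {1} 0 1<p) (digit-of-0 t)
  digit-pow zero    (suc e) = trans (cong (digit pr 0) (*-comm p (p ^ e))) (digit-zero-+* {0} (p ^ e) z<s)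
  digit-pow (suc t) (suc e) = trans (cong (digit pr (suc t)) (*-comm p (p ^ e)))
                                    (trans (digit-suc-+* t {0} (p ^ e) z<s) (digit-pow t e))

  digit-+ : ∀ t a b → (∀ s → digit pr s a + digit pr s b < p) → digit pr t (a + b) ≡ digit pr t a + digit pr t b
  digit-+ zero a b noCarry = begin
    digit pr 0 (a + b)      ≡⟨ digit-zero (a + b) ⟩
    (a + b) % p             ≡⟨ %-distribˡ-+ a b p ⟩
    (a % p + b % p) % p     ≡⟨ m<n⇒m%n≡m units<p ⟩
    a % p + b % p           ≡⟨ cong₂ _+_ (digit-zero a) (digit-zero b) ⟨
    digit pr 0 a + digit pr 0 b ∎
    where
    open ≡-Reasoning
    units<p : a % p + b % p < p
    units<p = subst (_< p) (cong₂ _+_ (digit-zero a) (digit-zero b)) (noCarry 0)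
  digit-+ (suc t) a b noCarry = begin
    digit pr (suc t) (a + b)          ≡⟨ digit-suc t (a + b) ⟩
    digit pr t ((a + b) / p)          ≡⟨ cong (digit pr t) (+-distrib-/ a b units<p) ⟩
    digit pr t (a / p + b / p)        ≡⟨ digit-+ t (a / p) (b / p) noCarry′ ⟩
    digit pr t (a / p) + digit pr t (b / p) ≡⟨ cong₂ _+_ (digit-suc t a) (digit-suc t b) ⟨
    digit pr (suc t) a + digit pr (suc t) b ∎
    where
    open ≡-Reasoning
    units<p : a % p + b % p < p
    units<p = subst (_< p) (cong₂ _+_ (digit-zero a) (digit-zero b)) (noCarry 0)
    noCarry′ : ∀ s → digit pr s (a / p) + digit pr s (b / p) < p
    noCarry′ s = subst (_< p) (cong₂ _+_ (digit-suc s a) (digit-suc s b)) (noCarry (suc s))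

  pow≤ : ∀ e n → 1 ≤ digit pr e n → p ^ e ≤ n
  pow≤ zero    n 1≤d = ≤-trans (subst (1 ≤_) (digit-zero n) 1≤d) (m%n≤m n p)
  pow≤ (suc e) n 1≤d = begin
    p ^ suc e    ≡⟨ *-comm p (p ^ e) ⟩
    p ^ e * p    ≤⟨ *-monoˡ-≤ p (pow≤ e (n / p) (subst (1 ≤_) (digit-suc e n) 1≤d)) ⟩
    n / p * p    ≤⟨ m/n*n≤m n p ⟩
    n            ∎
    where open ≤-Reasoning

  1≤digit⇒< : ∀ e n → 1 ≤ digit pr e n → e < n
  1≤digit⇒< e n 1≤d = <-≤-trans (n<m^n 1<p e) (pow≤ e n 1≤d)

  digit-∸-pow : ∀ e n → 1 ≤ digit pr e n → ∀ t → digit pr t n ≡ digit pr t (n ∸ p ^ e) + δ t e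
  digit-∸-pow zero n 1≤d = digits
    where
    r = n % p
    q = n / p
    1≤r : 1 ≤ r
    1≤r = subst (1 ≤_) (digit-zero n) 1≤d
    r∸1<p : r ∸ 1 < p
    r∸1<p = ≤-<-trans (m∸n≤m r 1) (m%n<n n p)
    n∸1≡ : n ∸ 1 ≡ (r ∸ 1) + q * p
    n∸1≡ = trans (cong (_∸ 1) (m≡m%n+[m/n]*n n p)) (+-∸-comm (q * p) 1≤r)
    digits : ∀ t → digit pr t n ≡ digit pr t (n ∸ 1) + δ t 0
    digits zero = begin
      digit pr 0 n            ≡⟨ digit-zero n ⟩
      r                       ≡⟨ m∸n+n≡m 1≤r ⟨
      r ∸ 1 + 1               ≡⟨ cong (_+ 1) (digit-zero-+* q r∸1<p) ⟨
      digit pr 0 (r ∸ 1 + q * p) + 1 ≡⟨ cong (λ m → digit pr 0 m + 1) n∸1≡ ⟨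
      digit pr 0 (n ∸ 1) + 1  ∎
      where open ≡-Reasoning
    digits (suc t) = begin
      digit pr (suc t) n                   ≡⟨ digit-suc t n ⟩
      digit pr t q                         ≡⟨ digit-suc-+* t q r∸1<p ⟨
      digit pr (suc t) (r ∸ 1 + q * p)     ≡⟨ cong (digit pr (suc t)) n∸1≡ ⟨
      digit pr (suc t) (n ∸ 1)             ≡⟨ +-identityʳ _ ⟨
      digit pr (suc t) (n ∸ 1) + 0         ∎
      where open ≡-Reasoning
  digit-∸-pow (suc e) n 1≤d = digits
    where
    r = n % p
    q = n / p
    r<p : r < p
    r<p = m%n<n n p
    1≤dq : 1 ≤ digit pr e q
    1≤dq = subst (1 ≤_) (digit-suc e n) 1≤d
    n∸pe≡ : n ∸ p ^ suc e ≡ r + (q ∸ p ^ e) * p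
    n∸pe≡ = begin
      n ∸ p ^ suc e           ≡⟨ cong₂ _∸_ (m≡m%n+[m/n]*n n p) (*-comm p (p ^ e)) ⟩
      r + q * p ∸ p ^ e * p   ≡⟨ +-∸-assoc r (*-monoˡ-≤ p (pow≤ e q 1≤dq)) ⟩
      r + (q * p ∸ p ^ e * p) ≡⟨ cong (r +_) (*-distribʳ-∸ p q (p ^ e)) ⟨
      r + (q ∸ p ^ e) * p     ∎
      where open ≡-Reasoning
    digits : ∀ t → digit pr t n ≡ digit pr t (n ∸ p ^ suc e) + δ t (suc e)
    digits zero = begin
      digit pr 0 n                         ≡⟨ digit-zero n ⟩
      r                                    ≡⟨ digit-zero-+* (q ∸ p ^ e) r<p ⟨
      digit pr 0 (r + (q ∸ p ^ e) * p)     ≡⟨ cong (digit pr 0) n∸pe≡ ⟨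
      digit pr 0 (n ∸ p ^ suc e)           ≡⟨ +-identityʳ _ ⟨
      digit pr 0 (n ∸ p ^ suc e) + 0       ∎
      where open ≡-Reasoning
    digits (suc t) = begin
      digit pr (suc t) n                             ≡⟨ digit-suc t n ⟩
      digit pr t q                                   ≡⟨ digit-∸-pow e q 1≤dq t ⟩
      digit pr t (q ∸ p ^ e) + δ t e                 ≡⟨ cong (_+ δ t e) (digit-suc-+* t (q ∸ p ^ e) r<p) ⟨
      digit pr (suc t) (r + (q ∸ p ^ e) * p) + δ t e ≡⟨ cong (λ m → digit pr (suc t) m + δ t e) n∸pe≡ ⟨
      digit pr (suc t) (n ∸ p ^ suc e) + δ t e       ∎
      where open ≡-Reasoning

  LowestDigit : ℕ → ℕ → Set
  LowestDigit e n = 1 ≤ digit pr e n × (∀ t → t < e → digit pr t n ≡ 0)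

  lowestDigit-suc⁺ : ∀ {e n} → n % p ≡ 0 → LowestDigit e (n / p) → LowestDigit (suc e) n
  lowestDigit-suc⁺ {e} {n} n%p≡0 (1≤d , below) = subst (1 ≤_) (sym (digit-suc e n)) 1≤d , below′
    where
    below′ : ∀ t → t < suc e → digit pr t n ≡ 0
    below′ zero    _         = trans (digit-zero n) n%p≡0
    below′ (suc t) (s≤s t<e) = trans (digit-suc t n) (below t t<e)

  lowestDigit-suc⁻ : ∀ {e n} → LowestDigit (suc e) n → n % p ≡ 0 × LowestDigit e (n / p)
  lowestDigit-suc⁻ {e} {n} (1≤d , below) =
    trans (sym (digit-zero n)) (below 0 z<s) ,
    subst (1 ≤_) (digit-suc e n) 1≤d ,
    λ t t<e → trans (sym (digit-suc t n)) (below (suc t) (s≤s t<e))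

  lowestDigit : ∀ n → 1 ≤ n → ∃ λ e → LowestDigit e n
  lowestDigit = <-rec (λ n → 1 ≤ n → ∃ λ e → LowestDigit e n) step
    where
    step : ∀ n → (∀ {m} → m < n → 1 ≤ m → ∃ λ e → LowestDigit e m) → 1 ≤ n → ∃ λ e → LowestDigit e n
    step n rec 1≤n with n % p ≟ 0
    ... | no  n%p≢0 = 0 , subst (1 ≤_) (sym (digit-zero n)) (n≢0⇒n>0 n%p≢0) , λ _ ()
    ... | yes n%p≡0 with rec (m/n<m n p {{>-nonZero 1≤n}} 1<p) 1≤n/p
      where
      1≤n/p : 1 ≤ n / p
      1≤n/p = n≢0⇒n>0 λ n/p≡0 →
        <⇒≢ 1≤n (sym (trans (n≡p*[n/p] n n%p≡0) (trans (cong (p *_) n/p≡0) (*-zeroʳ p))))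
    ...   | e , low = suc e , lowestDigit-suc⁺ n%p≡0 low

  zeroDigitsBelow⇒pow∣ : ∀ e n → (∀ t → t < e → digit pr t n ≡ 0) → p ^ e ∣ n
  zeroDigitsBelow⇒pow∣ zero    n _     = 1∣ n
  zeroDigitsBelow⇒pow∣ (suc e) n below =
    subst (p ^ suc e ∣_) (sym (n≡p*[n/p] n n%p≡0)) (*-monoʳ-∣ p (zeroDigitsBelow⇒pow∣ e (n / p) below′))
    where
    n%p≡0 : n % p ≡ 0
    n%p≡0 = trans (sym (digit-zero n)) (below 0 z<s)
    below′ : ∀ t → t < e → digit pr t (n / p) ≡ 0
    below′ t t<e = trans (sym (digit-suc t n)) (below (suc t) (s≤s t<e))

  lowestDigit⇒pow∤ : ∀ e n → LowestDigit e n → ¬ (p ^ suc e ∣ n)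
  lowestDigit⇒pow∤ zero    n (1≤d , _) p∣n =
    <⇒≢ (subst (1 ≤_) (digit-zero n) 1≤d) (sym (n∣m⇒m%n≡0 n p (subst (_∣ n) (*-identityʳ p) p∣n)))
  lowestDigit⇒pow∤ (suc e) n low pe∣n with lowestDigit-suc⁻ low
  ... | n%p≡0 , low′ =
    lowestDigit⇒pow∤ e (n / p) low′ (*-cancelˡ-∣ p (subst (p ^ suc (suc e) ∣_) (n≡p*[n/p] n n%p≡0) pe∣n))

  -- digitSum pr n is definitionally digitSumBelow (suc n) n; a common bound F makes digit sums
  -- of different numbers comparable.
  digitSumBelow : ℕ → ℕ → ℕ
  digitSumBelow F n = listSum (List.map (λ t → digit pr t n) (upTo F))

  digitSumBelow-+ : ∀ F {a b c} → (∀ t → digit pr t c ≡ digit pr t a + digit pr t b) →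
    digitSumBelow F c ≡ digitSumBelow F a + digitSumBelow F b
  digitSumBelow-+ F digits = sum-map-+ digits (upTo F)

  digitSumBelow-of-0 : ∀ F → digitSumBelow F 0 ≡ 0
  digitSumBelow-of-0 zero    = refl
  digitSumBelow-of-0 (suc F) =
    trans (sum-upTo-suc (λ t → digit pr t 0) F) (cong₂ _+_ (digitSumBelow-of-0 F) (digit-of-0 F))

  1≤digitSumBelow⇒1≤n : ∀ F n → 1 ≤ digitSumBelow F n → 1 ≤ n
  1≤digitSumBelow⇒1≤n F zero    1≤s = ⊥-elim (<⇒≢ 1≤s (sym (digitSumBelow-of-0 F)))
  1≤digitSumBelow⇒1≤n F (suc n) _   = s≤s z≤n

  digitSumBelow-∸-pow : ∀ {F} e n → n ≤ F → 1 ≤ digit pr e n →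
    digitSumBelow F n ≡ suc (digitSumBelow F (n ∸ p ^ e))
  digitSumBelow-∸-pow {F} e n n≤F 1≤d = begin
    digitSumBelow F n                                                       ≡⟨ sum-map-+ (digit-∸-pow e n 1≤d) (upTo F) ⟩
    digitSumBelow F (n ∸ p ^ e) + listSum (List.map (λ t → δ t e) (upTo F)) ≡⟨ cong (digitSumBelow F (n ∸ p ^ e) +_) (sum-δ-upTo e<F) ⟩
    digitSumBelow F (n ∸ p ^ e) + 1                                         ≡⟨ +-comm _ 1 ⟩
    suc (digitSumBelow F (n ∸ p ^ e))                                       ∎
    where
    open ≡-Reasoning
    e<F : e < F
    e<F = <-≤-trans (1≤digit⇒< e n 1≤d) n≤F

  digitSumBelow-pos : ∀ {F} n → 1 ≤ n → n ≤ F → 1 ≤ digitSumBelow F n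
  digitSumBelow-pos n 1≤n n≤F with lowestDigit n 1≤n
  ... | e , 1≤d , _ = subst (1 ≤_) (sym (digitSumBelow-∸-pow e n n≤F 1≤d)) (s≤s z≤n)

  LowestDigits : ℕ → List ℕ → Set
  LowestDigits n []       = ⊤
  LowestDigits n (e ∷ es) = LowestDigit e n × LowestDigits (n ∸ p ^ e) es

  lowestDigits⇒Greedy : ∀ n es → LowestDigits n es → Greedy p n es
  lowestDigits⇒Greedy n []       _            = tt
  lowestDigits⇒Greedy n (e ∷ es) (low , lows) =
    zeroDigitsBelow⇒pow∣ e n (proj₂ low) , lowestDigit⇒pow∤ e n low , lowestDigits⇒Greedy (n ∸ p ^ e) es lows

  lowestDigits-exist : ∀ {F} j n → n ≤ F → j ≤ digitSumBelow F n → ∃ λ es → length es ≡ j × LowestDigits n es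
  lowestDigits-exist         zero    n _   _   = [] , refl , tt
  lowestDigits-exist {F} (suc j) n n≤F j<s with lowestDigit n (1≤digitSumBelow⇒1≤n F n (≤-trans (s≤s z≤n) j<s))
  ... | e , low with lowestDigits-exist j (n ∸ p ^ e) (≤-trans (m∸n≤m n (p ^ e)) n≤F)
                       (s≤s⁻¹ (subst (suc j ≤_) (digitSumBelow-∸-pow e n n≤F (proj₁ low)) j<s))
  ... | es , refl , lows = e ∷ es , refl , low , lows

  remainder-pos : ∀ {F} n es → n ≤ F → LowestDigits n es → length es < digitSumBelow F n → 1 ≤ remainder p n es
  remainder-pos {F} n []       _   _            0<s   = 1≤digitSumBelow⇒1≤n F n 0<s
  remainder-pos {F} n (e ∷ es) n≤F (low , lows) len<s =
    remainder-pos (n ∸ p ^ e) es (≤-trans (m∸n≤m n (p ^ e)) n≤F) lows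
      (s≤s⁻¹ (subst (suc (length (e ∷ es)) ≤_) (digitSumBelow-∸-pow e n n≤F (proj₁ low)) len<s))

  greedySummands : ∀ n es → Vec ℕ (suc (length es))
  greedySummands n []       = n ∷ []
  greedySummands n (e ∷ es) = p ^ e ∷ greedySummands (n ∸ p ^ e) es

  remainder∈greedySummands : ∀ n es → remainder p n es ∈ greedySummands n es
  remainder∈greedySummands n []       = here refl
  remainder∈greedySummands n (e ∷ es) = there (remainder∈greedySummands (n ∸ p ^ e) es)

  greedySummands-acceptable : ∀ n es → LowestDigits n es → 1 ≤ remainder p n es →
    Acceptable pr n (suc (length es)) (greedySummands n es)
  greedySummands-acceptable n []       _                 1≤n = (1≤n ∷ []) , +-identityʳ n , λ t → sym (+-identityʳ _)
  greedySummands-acceptable n (e ∷ es) ((1≤d , _) , lows) 1≤r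
    with greedySummands-acceptable (n ∸ p ^ e) es lows 1≤r
  ... | positive , sum≡ , digits≡ =
    (m^n>0 p e ∷ positive) , trans (cong (p ^ e +_) sum≡) (m+[n∸m]≡n (pow≤ e n 1≤d)) , λ t → begin
      digit pr t n                                ≡⟨ digit-∸-pow e n 1≤d t ⟩
      digit pr t (n ∸ p ^ e) + δ t e              ≡⟨ +-comm _ (δ t e) ⟩
      δ t e + digit pr t (n ∸ p ^ e)              ≡⟨ cong₂ _+_ (sym (digit-pow t e)) (digits≡ t) ⟩
      digit pr t (p ^ e) + Vec.sum (Vec.map (digit pr t) (greedySummands (n ∸ p ^ e) es)) ∎
    where open ≡-Reasoning

  NoCarry : ∀ {m} → Vec ℕ m → Set
  NoCarry c = ∀ t → Vec.sum (Vec.map (digit pr t) c) < p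

  noCarry-tail : ∀ {m a} {c : Vec ℕ m} → NoCarry (a ∷ c) → NoCarry c
  noCarry-tail {a = a} noCarry t = ≤-<-trans (m≤n+m _ (digit pr t a)) (noCarry t)

  digit-Vec-sum : ∀ {m} (c : Vec ℕ m) → NoCarry c → ∀ t → digit pr t (Vec.sum c) ≡ Vec.sum (Vec.map (digit pr t) c)
  digit-Vec-sum []      _       t = digit-of-0 t
  digit-Vec-sum (a ∷ c) noCarry t =
    trans (digit-+ t a (Vec.sum c) noCarry-∷) (cong (digit pr t a +_) (digit-Vec-sum c noCarryᶜ t))
    where
    noCarryᶜ : NoCarry c
    noCarryᶜ = noCarry-tail {c = c} noCarry
    noCarry-∷ : ∀ s → digit pr s a + digit pr s (Vec.sum c) < p
    noCarry-∷ s = subst (_< p) (cong (digit pr s a +_) (sym (digit-Vec-sum c noCarryᶜ s))) (noCarry s)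

  length≤digitSumBelow : ∀ {F m} (c : Vec ℕ m) → All (1 ≤_) c → Vec.sum c ≤ F → NoCarry c →
    m ≤ digitSumBelow F (Vec.sum c)
  length≤digitSumBelow          []      _              _     _       = z≤n
  length≤digitSumBelow {F} (a ∷ c) (1≤a ∷ positive) sum≤F noCarry = begin
    suc _                                           ≤⟨ +-mono-≤ (digitSumBelow-pos a 1≤a a≤F)
                                                         (length≤digitSumBelow c positive sumᶜ≤F noCarryᶜ) ⟩
    digitSumBelow F a + digitSumBelow F (Vec.sum c) ≡⟨ digitSumBelow-+ F digits-∷ ⟨
    digitSumBelow F (a + Vec.sum c)                 ∎
    where
    open ≤-Reasoning
    a≤F : a ≤ F
    a≤F = ≤-trans (m≤m+n a _) sum≤F
    sumᶜ≤F : Vec.sum c ≤ F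
    sumᶜ≤F = ≤-trans (m≤n+m _ a) sum≤F
    noCarryᶜ : NoCarry c
    noCarryᶜ = noCarry-tail {c = c} noCarry
    digits-∷ : ∀ t → digit pr t (a + Vec.sum c) ≡ digit pr t a + digit pr t (Vec.sum c)
    digits-∷ t = trans (digit-Vec-sum (a ∷ c) noCarry t) (cong (digit pr t a +_) (sym (digit-Vec-sum c noCarryᶜ t)))

  infix 4 _≼_
  _≼_ : ℕ → ℕ → Set
  y ≼ n = ∀ t → digit pr t y ≤ digit pr t n

  lowestDigit-≼ : ∀ {e n w y} → LowestDigit e n → LowestDigit w y → y ≼ n → e ≤ w
  lowestDigit-≼ {w = w} (_ , belowN) (1≤dy , _) y≼n = ≮⇒≥ λ w<e →
    <⇒≱ 1≤dy (≤-trans (y≼n w) (≤-reflexive (belowN w w<e)))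

  ∸-pow-≼ : ∀ {e n w y} → LowestDigit e n → LowestDigit w y → y ≼ n → y ∸ p ^ w ≼ n ∸ p ^ e
  ∸-pow-≼ {e} {n} {w} {y} lowN@(1≤dn , _) lowY@(1≤dy , belowY) y≼n t =
    byPosition (t ≟ e) (m≤n⇒m<n∨m≡n (lowestDigit-≼ lowN lowY y≼n))
    where
    shifted : digit pr t (y ∸ p ^ w) + δ t w ≤ digit pr t (n ∸ p ^ e) + δ t e
    shifted = subst₂ _≤_ (digit-∸-pow w y 1≤dy t) (digit-∸-pow e n 1≤dn t) (y≼n t)
    byPosition : Dec (t ≡ e) → e < w ⊎ e ≡ w → digit pr t (y ∸ p ^ w) ≤ digit pr t (n ∸ p ^ e)
    byPosition (no t≢e) _ = ≤-trans (m≤m+n _ (δ t w)) (subst (digit pr t (y ∸ p ^ w) + δ t w ≤_) δ≡0 shifted)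
      where
      δ≡0 : digit pr t (n ∸ p ^ e) + δ t e ≡ digit pr t (n ∸ p ^ e)
      δ≡0 = trans (cong (digit pr t (n ∸ p ^ e) +_) (δ-≢ t≢e)) (+-identityʳ _)
    byPosition (yes t≡e) (inj₁ e<w) = ≤-trans (m≤m+n _ (δ t w)) (≤-trans (≤-reflexive digit≡0) z≤n)
      where
      digit≡0 : digit pr t (y ∸ p ^ w) + δ t w ≡ 0
      digit≡0 = trans (sym (digit-∸-pow w y 1≤dy t)) (belowY t (subst (_< w) (sym t≡e) e<w))
    byPosition (yes _) (inj₂ e≡w) = +-cancelʳ-≤ (δ t e) _ _ (subst (λ v → _ + δ t v ≤ _) (sym e≡w) shifted)

  powSum : List ℕ → ℕ
  powSum es = listSum (List.map (p ^_) es)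

  remainder≡∸powSum : ∀ n es → remainder p n es ≡ n ∸ powSum es
  remainder≡∸powSum n []       = refl
  remainder≡∸powSum n (e ∷ es) = trans (remainder≡∸powSum (n ∸ p ^ e) es) (∸-+-assoc n (p ^ e) (powSum es))

  powSum≤ : ∀ {F} n es y → LowestDigits n es → y ≼ n → y ≤ F → length es ≤ digitSumBelow F y → powSum es ≤ y
  powSum≤       n []       y _            _   _   _     = z≤n
  powSum≤ {F} n (e ∷ es) y (lowN , lows) y≼n y≤F len≤s
    with lowestDigit y (1≤digitSumBelow⇒1≤n F y (≤-trans (s≤s z≤n) len≤s))
  ... | w , lowY@(1≤dy , _) = begin
    p ^ e + powSum es    ≤⟨ +-mono-≤ (^-monoʳ-≤ p (lowestDigit-≼ lowN lowY y≼n))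
                                     (powSum≤ (n ∸ p ^ e) es (y ∸ p ^ w) lows (∸-pow-≼ lowN lowY y≼n) y∸≤F len≤s′) ⟩
    p ^ w + (y ∸ p ^ w)  ≡⟨ m+[n∸m]≡n (pow≤ w y 1≤dy) ⟩
    y                    ∎
    where
    open ≤-Reasoning
    y∸≤F : y ∸ p ^ w ≤ F
    y∸≤F = ≤-trans (m∸n≤m y (p ^ w)) y≤F
    len≤s′ : length es ≤ digitSumBelow F (y ∸ p ^ w)
    len≤s′ = s≤s⁻¹ (subst (suc (length es) ≤_) (digitSumBelow-∸-pow w y y≤F 1≤dy) len≤s)

  summand≤remainder : ∀ N es {c : Vec ℕ (suc (length es))} {x} → LowestDigits N es →
    Acceptable pr N (suc (length es)) c → x ∈ c → x ≤ remainder p N es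
  summand≤remainder N es {c} {x} lows (positive , sum≡N , digits≡) x∈c with split-∈ x∈c
  ... | c′ , sum-split , all′ = begin
    x                   ≡⟨ m+n∸n≡m x y ⟨
    x + y ∸ y           ≡⟨ cong (_∸ y) N≡x+y ⟨
    N ∸ y               ≤⟨ ∸-monoʳ-≤ N (powSum≤ N es y lows y≼N y≤N len≤s) ⟩
    N ∸ powSum es       ≡⟨ remainder≡∸powSum N es ⟨
    remainder p N es    ∎
    where
    open ≤-Reasoning
    y = Vec.sum c′
    N≡x+y : N ≡ x + y
    N≡x+y = begin-equality
      N                          ≡⟨ sum≡N ⟨
      Vec.sum c                  ≡⟨ cong Vec.sum (map-id c) ⟨
      Vec.sum (Vec.map id c)     ≡⟨ sum-split id ⟩
      x + Vec.sum (Vec.map id c′) ≡⟨ cong (λ s → x + Vec.sum s) (map-id c′) ⟩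
      x + y                      ∎
    y≤N : y ≤ N
    y≤N = subst (y ≤_) (sym N≡x+y) (m≤n+m y x)
    digitsN : ∀ t → digit pr t N ≡ digit pr t x + Vec.sum (Vec.map (digit pr t) c′)
    digitsN t = trans (digits≡ t) (sum-split (digit pr t))
    noCarry : NoCarry c′
    noCarry t = ≤-<-trans (m≤n+m _ (digit pr t x)) (subst (_< p) (digitsN t) (digit<p t N))
    len≤s : length es ≤ digitSumBelow N y
    len≤s = length≤digitSumBelow c′ (all′ positive) y≤N noCarry
    y≼N : y ≼ N
    y≼N t = subst₂ _≤_ (sym (digit-Vec-sum c′ noCarry t)) (sym (digitsN t)) (m≤n+m _ (digit pr t x))

lemma8p3 : (p : ℕ) (pr : Prime p) (N k : ℕ) → 1 ≤ N → 1 ≤ k → k ≤ digitSum pr N →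
    Σ (List ℕ) (λ es → length es ≡ k ∸ 1 × Greedy p N es × IsThreshold pr N k (remainder p N es))
lemma8p3 zero             pr _ _       _ _  _   = ⊥-elim (¬prime[0] pr)
lemma8p3 (suc zero)       pr _ _       _ _  _   = ⊥-elim (¬prime[1] pr)
lemma8p3 (suc (suc _))    pr N zero    _ () _
lemma8p3 (suc (suc _))    pr N (suc j) _ _  k≤s with Digits.lowestDigits-exist pr j N (n≤1+n N) (≤-trans (n≤1+n j) k≤s)
... | es , refl , lows =
  es , refl , lowestDigits⇒Greedy N es lows ,
  (greedySummands N es ,
   greedySummands-acceptable N es lows (remainder-pos N es (n≤1+n N) lows k≤s) ,
   remainder∈greedySummands N es) ,
  λ c acceptable x x∈c → summand≤remainder N es lows acceptable x∈c
  where open Digits pr
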